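{- Let $\mathcal{J},\mathcal{K}$ be ideals on $\omega$. (1) If $\mathcal{I}=\mathcal{J}\otimes\mathcal{K}$ or $\mathcal{I}=\mathcal{J}\otimes\{\emptyset\}$, then $\mathfrak{b}_s(\mathrm{Fin},\mathcal{I},\mathcal{I})=\aleph_0$. (2) If $\mathcal{I}=\{\emptyset\}\otimes\mathcal{K}$, then $\mathfrak{b}_s(\mathrm{Fin},\mathcal{I},\mathcal{I})=\mathfrak{b}_s(\mathrm{Fin},\mathcal{K},\mathcal{K})$.
   Context: An ideal on a countable infinite set $X$ is a family $\mathcal{I}\subseteq\mathcal{P}(X)$ closed under finite unions and subsets, containing all finite subsets, with $X\notin\mathcal{I}$; $\mathrm{Fin}$ denotes the ideal of finite subsets of the relevant set. For $A\subseteq\omega\times\omega$ and $x\in\omega$, $(A)_x=\{y:(x,y)\in A\}$. For ideals $\mathcal{J},\mathcal{K}$ on $\omega$: $\mathcal{J}\otimes\mathcal{K}=\{A\subseteq\omega\times\omega:\{x:(A)_x\notin\mathcal{K}\}\in\mathcal{J}\}$, $\mathcal{J}\otimes\{\emptyset\}=\{A\subseteq\omega\times\omega:\{x:(A)_x\ne\emptyset\}\in\mathcal{J}\}$, $\{\emptyset\}\otimes\mathcal{K}=\{A\subseteq\omega\times\omega:(A)_x\in\mathcal{K}\text{ for all }x\}$. For an ideal $\mathcal{K}$ on $X$, $\widehat{\mathcal{P}}_{\mathcal{K}}$ is the family of sequences $\langle A_n:n\in\omega\rangle$ of pairwise disjoint members of $\mathcal{K}$, and $\mathcal{P}_{\mathcal{K}}$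 those with union $X$. For ideals $\mathcal{I},\mathcal{J},\mathcal{K}$ on $X$: $\mathfrak{b}_s(\mathcal{I},\mathcal{J},\mathcal{K})=\min\{|\mathcal{E}|:\mathcal{E}\subseteq\widehat{\mathcal{P}}_{\mathcal{K}},\ \forall\langle A_n\rangle\in\mathcal{P}_{\mathcal{J}}\ \exists\langle E_n\rangle\in\mathcal{E}\ \bigcup_n(A_{n+1}\cap\bigcup_{i\le n}E_i)\notin\mathcal{I}\}$, with $\min\emptyset=\mathfrak{c}^+$. -}

module Defs where

open import Data.Nat using (ℕ; suc; _≤_)
open import Data.Fin using (Fin)
open import Data.Product using (Σ; _×_; _,_)
open import Data.Sum using (_⊎_)
open import Data.Unit using (⊤)
open import Data.Empty using (⊥)
open import Data.List using (List)
open import Data.List.Membership.Propositional using (_∈_)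
open import Relation.Nullary using (¬_)
open import Relation.Binary.PropositionalEquality using (_≢_)

Subset : Set → Set₁
Subset X = X → Set

Family : Set → Set₁
Family X = Subset X → Set

_⊆_ : {X : Set} → Subset X → Subset X → Set
A ⊆ B = ∀ x → A x → B x

_∪_ : {X : Set} → Subset X → Subset X → Subset X
(A ∪ B) x = A x ⊎ B x

Finite : {X : Set} → Subset X → Set
Finite {X} A = Σ (List X) λ l → ∀ x → A x → x ∈ l

record IsIdeal {X : Set} (I : Family X) : Set₁ where
  field
    down   : ∀ (A B : Subset X) → A ⊆ B → I B → I A
    union  : ∀ (A B : Subset X) → I A → I B → I (A ∪ B)
    finite : ∀ (A : Subset X) → Finite A → I A
    proper : ¬ I (λ _ → ⊤)

FinIdeal : {X : Set} → Family X
FinIdeal = Finite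

section : Subset (ℕ × ℕ) → ℕ → Subset ℕ
section A x y = A (x , y)

_⊗_ : Family ℕ → Family ℕ → Family (ℕ × ℕ)
(J ⊗ K) A = J (λ x → ¬ K (section A x))

_⊗∅ : Family ℕ → Family (ℕ × ℕ)
(J ⊗∅) A = J (λ x → Σ ℕ λ y → section A x y)

∅⊗_ : Family ℕ → Family (ℕ × ℕ)
(∅⊗ K) A = ∀ x → K (section A x)

Seq : Set → Set₁
Seq X = ℕ → Subset X

PairwiseDisjoint : {X : Set} → Seq X → Set
PairwiseDisjoint A = ∀ m n → m ≢ n → ∀ x → A m x → A n x → ⊥

PHat : {X : Set} → Family X → Seq X → Set
PHat K A = (∀ n → K (A n)) × PairwiseDisjoint A

Part : {X : Set} → Family X → Seq X → Set
Part K A = PHat K A × (∀ x → Σ ℕ λ n → A n x)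

Bad : {X : Set} → Seq X → Seq X → Subset X
Bad A E x = Σ ℕ λ n → A (suc n) x × Σ ℕ λ i → i ≤ n × E i x

Witness : {X : Set} → Family X → Family X → Family X → (S : Set) → (S → Seq X) → Set₁
Witness I J K S E =
  (∀ s → PHat K (E s)) × (∀ A → Part J A → Σ S λ s → ¬ I (Bad A (E s)))

-- b_s(I,J,K) ≤ |S| (and b_s(I,J,K) ≤ 𝔠, i.e. the min is over a nonempty set):
-- some family of at most |S| elements witnesses the definition.
BsAtMost : {X : Set} → Family X → Family X → Family X → Set → Set₁
BsAtMost {X} I J K S = Σ (S → Seq X) λ E → Witness I J K S E

-- b_s(I,J,K) = ℵ₀ : some countable family witnesses, and no finite one does.
BsIsAleph0 : {X : Set} → Family X → Family X → Family X → Set₁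
BsIsAleph0 I J K = BsAtMost I J K ℕ × (∀ n → ¬ BsAtMost I J K (Fin n))

{-# OPTIONS --safe #-}
module Submission where

open import Defs
open import Level using (0ℓ)
open import Data.Nat using (ℕ; zero; suc; _+_; _∸_; _≤_; _<_; z≤n; s≤s; s≤s⁻¹; _≟_)
open import Data.Nat.Properties
open import Data.Nat.Induction using (<-rec)
open import Data.Fin using (Fin; toℕ; fromℕ<) renaming (zero to fzero; suc to fsuc)
open import Data.Fin.Properties using (toℕ<n; toℕ-fromℕ<)
open import Data.Product using (Σ; ∃; _×_; _,_; proj₁; proj₂)
open import Data.Sum using (_⊎_; inj₁; inj₂)
open import Data.Empty using (⊥; ⊥-elim)
open import Data.List using (List; []; _∷_; map; concatMap; upTo)
open import Data.List.Extrema.Nat using (max; xs≤max)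
open import Data.List.Relation.Unary.All using (lookup)
open import Data.List.Relation.Unary.Any as Any using (here)
open import Data.List.Membership.Propositional using (_∈_)
open import Data.List.Membership.Propositional.Properties using (∈-map⁺; ∈-upTo⁺; ∈-concatMap⁺)
open import Relation.Nullary using (¬_; yes; no)
open import Relation.Binary.PropositionalEquality using (_≡_; refl; sym; trans; cong; subst)
open import Function.Bundles using (_⇔_; mk⇔)
open import Axiom.ExcludedMiddle using (ExcludedMiddle)
open import Axiom.DoubleNegationElimination using (em⇒dne)

-- (1) Given finitely many sequences Eˢ, put each point into the first index at
-- which some Eˢ contains it (at the index of its column if there is none). This
-- partition never meets Eˢᵢ at an index later than i, so every set
-- ⋃ₙ (Aₙ₊₁ ∩ ⋃_{i≤n} Eˢᵢ) is empty. Countably many sequences suffice: take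
-- (column s, ∅, ∅, …) for each s. If each of them met a partition in a finite set
-- only, the first piece A₀ would be cofinite in every column, and no member of
-- J ⊗ K or J ⊗ {∅} is.
-- (2) Restricting partitions of ω × ω to one column turns a witness for K into
-- one for {∅} ⊗ K. Conversely, a witness for {∅} ⊗ K is collapsed along the
-- diagonals i + x ≤ j and made disjoint; it is tested against the partition whose
-- column x is the given partition of ω with its first x + 1 pieces merged.

record IsLatticeIdeal {X : Set} (I : Family X) : Set₁ where
  field
    down  : ∀ (A B : Subset X) → A ⊆ B → I B → I A
    union : ∀ (A B : Subset X) → I A → I B → I (A ∪ B)
    empty : I (λ _ → ⊥)

IsIdeal⇒IsLatticeIdeal : {X : Set} {I : Family X} → IsIdeal I → IsLatticeIdeal I
IsIdeal⇒IsLatticeIdeal I-ideal = record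
  { down  = down
  ; union = union
  ; empty = finite _ ([] , λ _ ())
  }
  where open IsIdeal I-ideal

module _ {X : Set} {I : Family X} (I-ideal : IsLatticeIdeal I) where
  open IsLatticeIdeal I-ideal

  ⋃-Fin-closed : ∀ n (F : Fin n → Subset X) → (∀ s → I (F s)) →
                 I (λ x → Σ (Fin n) λ s → F s x)
  ⋃-Fin-closed zero    F F∈ = down _ _ (λ { _ (() , _) }) empty
  ⋃-Fin-closed (suc n) F F∈ =
    down _ _ split (union _ _ (F∈ fzero) (⋃-Fin-closed n (λ s → F (fsuc s)) (λ s → F∈ (fsuc s))))
    where
    split : (λ x → Σ (Fin (suc n)) λ s → F s x) ⊆ (F fzero ∪ λ x → Σ (Fin n) λ s → F (fsuc s) x)
    split x (fzero , p)  = inj₁ p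
    split x (fsuc s , p) = inj₂ (s , p)

  ⋃≤-closed : ∀ n (F : ℕ → Subset X) → (∀ k → k ≤ n → I (F k)) →
              I (λ x → Σ ℕ λ k → k ≤ n × F k x)
  ⋃≤-closed n F F∈ =
    down _ _ asFin (⋃-Fin-closed (suc n) (λ s → F (toℕ s)) (λ s → F∈ (toℕ s) (s≤s⁻¹ (toℕ<n s))))
    where
    asFin : (λ x → Σ ℕ λ k → k ≤ n × F k x) ⊆ (λ x → Σ (Fin (suc n)) λ s → F (toℕ s) x)
    asFin x (k , k≤n , p) = fromℕ< (s≤s k≤n) , subst (λ j → F j x) (sym (toℕ-fromℕ< (s≤s k≤n))) p

Cofinite : {X : Set} → Subset X → Set
Cofinite {X} B = Σ (List X) λ L → ∀ x → B x ⊎ x ∈ L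

ColumnwiseCofinite : Subset (ℕ × ℕ) → Set
ColumnwiseCofinite A = ∀ x → Cofinite (section A x)

ideal∌cofinite : {X : Set} {K : Family X} → IsIdeal K → ∀ {B} → K B → ¬ Cofinite B
ideal∌cofinite K-ideal B∈K (L , cover) =
  proper (down _ _ (λ x _ → cover x) (union _ _ B∈K (finite _ (L , λ _ x∈L → x∈L))))
  where open IsIdeal K-ideal

cofinite⇒nonempty : {B : Subset ℕ} → Cofinite B → Σ ℕ B
cofinite⇒nonempty (L , cover) with cover (suc (max 0 L))
... | inj₁ b   = _ , b
... | inj₂ m∈L = ⊥-elim (1+n≰n (lookup (xs≤max 0 L) m∈L))

finite-⊆ : {X : Set} {A B : Subset X} → A ⊆ B → Finite B → Finite A
finite-⊆ A⊆B (L , cover) = L , λ x a → cover x (A⊆B x a)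

finite-section : {X Y : Set} {A : Subset (X × Y)} → Finite A → ∀ x → Finite (λ y → A (x , y))
finite-section (L , cover) x = map proj₂ L , λ y a → ∈-map⁺ proj₂ (cover (x , y) a)

finite-below : (b : ℕ → ℕ) {B : Subset ℕ} → Finite B →
               Finite (λ (p : ℕ × ℕ) → B (proj₂ p) × proj₁ p < b (proj₂ p))
finite-below b {B} (L , cover) = concatMap row L , below
  where
  row : ℕ → List (ℕ × ℕ)
  row y = map (_, y) (upTo (b y))
  below : ∀ p → B (proj₂ p) × proj₁ p < b (proj₂ p) → p ∈ concatMap row L
  below (x , y) (By , x<by) =
    ∈-concatMap⁺ row (Any.map (λ { refl → ∈-map⁺ (_, y) (∈-upTo⁺ x<by) }) (cover y By))

IsLeast : (ℕ → Set) → ℕ → Set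
IsLeast P k = P k × (∀ j → P j → k ≤ j)

least-unique : ∀ {P m n} → IsLeast P m → IsLeast P n → m ≡ n
least-unique (pm , m≤) (pn , n≤) = ≤-antisym (m≤ _ pn) (n≤ _ pm)

least-exists : ExcludedMiddle 0ℓ → (P : ℕ → Set) → ∀ {m} → P m → ∃ λ k → k ≤ m × IsLeast P k
least-exists em P {m} = <-rec (λ m → P m → ∃ λ k → k ≤ m × IsLeast P k) step m
  where
  step : ∀ m → (∀ {j} → j < m → P j → ∃ λ k → k ≤ j × IsLeast P k) →
         P m → ∃ λ k → k ≤ m × IsLeast P k
  step m below pm with em {∃ λ j → j < m × P j}
  ... | yes (j , j<m , pj) = let k , k≤j , least = below j<m pj in k , ≤-trans k≤j (<⇒≤ j<m) , least
  ... | no none            = m , ≤-refl , pm , λ j pj → ≮⇒≥ (λ j<m → none (j , j<m , pj))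

pairwiseDisjoint-unique : {X : Set} {A : Seq X} → PairwiseDisjoint A →
                          ∀ {m n x} → A m x → A n x → m ≡ n
pairwiseDisjoint-unique A-disj {m} {n} a b with m ≟ n
... | yes m≡n = m≡n
... | no  m≢n = ⊥-elim (A-disj m n m≢n _ a b)

-- Classically, disjointed U k = U k ∖ ⋃_{j<k} U j.
disjointed : {X : Set} → Seq X → Seq X
disjointed U k x = IsLeast (λ j → U j x) k

disjointed-⊆ : {X : Set} (U : Seq X) → ∀ k → disjointed U k ⊆ U k
disjointed-⊆ U k x = proj₁

disjointed-pairwiseDisjoint : {X : Set} (U : Seq X) → PairwiseDisjoint (disjointed U)
disjointed-pairwiseDisjoint U m n m≢n x dm dn = m≢n (least-unique dm dn)

disjointed-cover : ExcludedMiddle 0ℓ → {X : Set} (U : Seq X) →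
                   ∀ {j x} → U j x → ∃ λ k → k ≤ j × disjointed U k x
disjointed-cover em U {x = x} = least-exists em (λ j → U j x)

¬BsAtMost-Fin : ExcludedMiddle 0ℓ → {X : Set} {I : Family X} → IsLatticeIdeal I →
                (c : X → ℕ) → (∀ k → I (λ x → c x ≡ k)) → ∀ n → ¬ BsAtMost FinIdeal I I (Fin n)
¬BsAtMost-Fin em {X} {I} I-ideal c fibre∈ n (E , E∈ , wit) =
  proj₂ (wit A A-part) (finite-⊆ Bad-empty ([] , λ _ ()))
  where
  open IsLatticeIdeal I-ideal
  U : Seq X
  U k x = (Σ (Fin n) λ s → E s k x) ⊎ c x ≡ k
  A : Seq X
  A = disjointed U
  U∈ : ∀ k → I (U k)
  U∈ k = union _ _ (⋃-Fin-closed I-ideal n (λ s → E s k) (λ s → proj₁ (E∈ s) k)) (fibre∈ k)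
  A-part : Part I A
  A-part = ((λ k → down _ _ (disjointed-⊆ U k) (U∈ k)) , disjointed-pairwiseDisjoint U)
         , λ x → let k , _ , first = disjointed-cover em U (inj₂ refl) in k , first
  Bad-empty : ∀ {s} → Bad A (E s) ⊆ λ _ → ⊥
  Bad-empty x (m , (_ , first) , i , i≤m , e) = 1+n≰n (≤-trans (first i (inj₁ (_ , e))) i≤m)

column : ℕ → Subset (ℕ × ℕ)
column s p = proj₁ p ≡ s

headSeq : {X : Set} → Subset X → Seq X
headSeq B zero    = B
headSeq B (suc _) = λ _ → ⊥

Bad-headSeq-column : {A : Seq (ℕ × ℕ)} → (∀ p → Σ ℕ λ n → A n p) →
                     ∀ s → Finite (Bad A (headSeq (column s))) → Cofinite (section (A 0) s)
Bad-headSeq-column {A} cover s fin with finite-section fin s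
... | L , Bad∈L = L , λ y → inA₀-or-Bad y (cover (s , y))
  where
  inA₀-or-Bad : ∀ y → Σ ℕ (λ n → A n (s , y)) → A 0 (s , y) ⊎ y ∈ L
  inA₀-or-Bad y (zero , a)  = inj₁ a
  inA₀-or-Bad y (suc m , a) = inj₂ (Bad∈L y (m , a , 0 , z≤n , refl))

BsAtMost-ℕ-columns : ExcludedMiddle 0ℓ → {I : Family (ℕ × ℕ)} → IsLatticeIdeal I →
                     (∀ s → I (column s)) → (∀ {A} → I A → ¬ ColumnwiseCofinite A) →
                     BsAtMost FinIdeal I I ℕ
BsAtMost-ℕ-columns em {I} I-ideal column∈ ∌cofinite = E , E∈ , wit
  where
  open IsLatticeIdeal I-ideal
  E : ℕ → Seq (ℕ × ℕ)
  E s = headSeq (column s)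
  E∈ : ∀ s → PHat I (E s)
  E∈ s = member , disjoint
    where
    member : ∀ i → I (E s i)
    member zero    = column∈ s
    member (suc _) = empty
    disjoint : PairwiseDisjoint (E s)
    disjoint zero    zero    0≢0 _ _ _ = 0≢0 refl
    disjoint zero    (suc n) _   _ _ ()
    disjoint (suc m) _       _   _ ()
  wit : ∀ A → Part I A → Σ ℕ λ s → ¬ FinIdeal (Bad A (E s))
  wit A ((A∈ , _) , cover) with em {Σ ℕ λ s → ¬ Finite (Bad A (E s))}
  ... | yes found = found
  ... | no  none  = ⊥-elim (∌cofinite (A∈ 0) λ s →
                      Bad-headSeq-column cover s (em⇒dne em λ ¬fin → none (s , ¬fin)))

module _ {J : Family ℕ} (J-ideal : IsIdeal J) where
  open IsIdeal J-ideal

  singleton-finite : ∀ s → Finite (λ (x : ℕ) → x ≡ s)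
  singleton-finite s = (s ∷ []) , λ _ → here

  ⊗∅-isLatticeIdeal : IsLatticeIdeal (J ⊗∅)
  ⊗∅-isLatticeIdeal = record
    { down  = λ A B A⊆B → down _ _ (λ x (y , a) → y , A⊆B _ a)
    ; union = λ A B A∈ B∈ → down _ _ nonempty-∪ (union _ _ A∈ B∈)
    ; empty = finite _ ([] , λ _ ())
    }
    where
    nonempty-∪ : ∀ {A B : Subset (ℕ × ℕ)} x → Σ ℕ (λ y → (A ∪ B) (x , y)) →
                 Σ ℕ (λ y → A (x , y)) ⊎ Σ ℕ (λ y → B (x , y))
    nonempty-∪ x (y , inj₁ a) = inj₁ (y , a)
    nonempty-∪ x (y , inj₂ b) = inj₂ (y , b)

  column∈J⊗∅ : ∀ s → (J ⊗∅) (column s)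
  column∈J⊗∅ s = down _ _ (λ x → proj₂) (finite _ (singleton-finite s))

  J⊗∅∌columnwiseCofinite : ∀ {A} → (J ⊗∅) A → ¬ ColumnwiseCofinite A
  J⊗∅∌columnwiseCofinite A∈ cofinite =
    proper (down _ _ (λ x _ → cofinite⇒nonempty (cofinite x)) A∈)

  module _ {K : Family ℕ} (K-ideal : IsIdeal K) where
    module K = IsIdeal K-ideal

    ⊗-isLatticeIdeal : ExcludedMiddle 0ℓ → IsLatticeIdeal (J ⊗ K)
    ⊗-isLatticeIdeal em = record
      { down  = λ A B A⊆B → down _ _ (λ x ¬KA KB → ¬KA (K.down _ _ (λ y → A⊆B (x , y)) KB))
      ; union = λ A B A∈ B∈ → down _ _ ¬K-∪ (union _ _ A∈ B∈)
      ; empty = down _ (λ _ → ⊥) (λ x ¬K∅ → ¬K∅ (K.finite (λ _ → ⊥) ([] , λ _ ())))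
                     (finite (λ _ → ⊥) ([] , λ _ ()))
      }
      where
      ¬K-∪ : ∀ {A B : Subset (ℕ × ℕ)} x → ¬ K (section (A ∪ B) x) →
             ¬ K (section A x) ⊎ ¬ K (section B x)
      ¬K-∪ {A} {B} x ¬KA∪B with em {K (section A x)} | em {K (section B x)}
      ... | yes KA | yes KB = ⊥-elim (¬KA∪B (K.union _ _ KA KB))
      ... | no ¬KA | _      = inj₁ ¬KA
      ... | yes _  | no ¬KB = inj₂ ¬KB

    column∈J⊗K : ∀ s → (J ⊗ K) (column s)
    column∈J⊗K s = down _ _ only-s (finite _ (singleton-finite s))
      where
      only-s : ∀ x → ¬ K (λ _ → x ≡ s) → x ≡ s
      only-s x ¬K with x ≟ s
      ... | yes x≡s = x≡s
      ... | no  x≢s = ⊥-elim (¬K (K.finite _ ([] , λ _ x≡s → ⊥-elim (x≢s x≡s))))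

    J⊗K∌columnwiseCofinite : ∀ {A} → (J ⊗ K) A → ¬ ColumnwiseCofinite A
    J⊗K∌columnwiseCofinite A∈ cofinite =
      proper (down _ _ (λ x _ K∋ → ideal∌cofinite K-ideal K∋ (cofinite x)) A∈)

Part-∅⊗-section : {K : Family ℕ} {A : Seq (ℕ × ℕ)} → Part (∅⊗ K) A →
                  ∀ x → Part K (λ n → section (A n) x)
Part-∅⊗-section ((A∈ , A-disj) , cover) x =
  ((λ n → A∈ n x) , λ m n m≢n y → A-disj m n m≢n (x , y)) , λ y → cover (x , y)

BsAtMost-K⇒BsAtMost-∅⊗K : {K : Family ℕ} {S : Set} →
                          BsAtMost FinIdeal K K S → BsAtMost FinIdeal (∅⊗ K) (∅⊗ K) S
BsAtMost-K⇒BsAtMost-∅⊗K {K} {S} (E , E∈ , wit) = E′ , E′∈ , wit′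
  where
  E′ : S → Seq (ℕ × ℕ)
  E′ s i p = E s i (proj₂ p)
  E′∈ : ∀ s → PHat (∅⊗ K) (E′ s)
  E′∈ s = (λ i _ → proj₁ (E∈ s) i) , λ m n m≢n p → proj₂ (E∈ s) m n m≢n (proj₂ p)
  wit′ : ∀ A → Part (∅⊗ K) A → Σ S λ s → ¬ FinIdeal (Bad A (E′ s))
  wit′ A A-part with wit _ (Part-∅⊗-section {K} A-part 0)
  ... | s , ¬fin = s , λ fin → ¬fin (finite-section fin 0)

-- In column x, k ∸ x merges A₀, …, Aₓ into piece 0 and shifts the later pieces down by x.
staircase : Seq ℕ → Seq (ℕ × ℕ)
staircase A n (x , y) = Σ ℕ λ k → A k y × k ∸ x ≡ n

staircase-part : {K : Family ℕ} → IsLatticeIdeal K → {A : Seq ℕ} → Part K A → Part (∅⊗ K) (staircase A)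
staircase-part {K} K-ideal {A} ((A∈ , A-disj) , cover) =
  (member , disjoint) , λ (x , y) → let k , a = cover y in k ∸ x , k , a , refl
  where
  open IsLatticeIdeal K-ideal
  member : ∀ n → (∅⊗ K) (staircase A n)
  member n x = down _ _ bounded (⋃≤-closed K-ideal (x + n) A (λ k _ → A∈ k))
    where
    bounded : section (staircase A n) x ⊆ λ y → Σ ℕ λ k → k ≤ x + n × A k y
    bounded y (k , a , k∸x≡n) = k , subst (λ m → k ≤ x + m) k∸x≡n (m≤n+m∸n k x) , a
  disjoint : PairwiseDisjoint (staircase A)
  disjoint m n m≢n (x , y) (k , a , refl) (k′ , a′ , refl) =
    m≢n (cong (_∸ x) (pairwiseDisjoint-unique A-disj a a′))

m∸n≡1+o⇒m≡1+o+n : ∀ {m n o} → m ∸ n ≡ suc o → m ≡ suc (o + n)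
m∸n≡1+o⇒m≡1+o+n {m} {n} m∸n≡1+o =
  trans (sym (m∸n+n≡m (<⇒≤ n<m))) (cong (_+ n) m∸n≡1+o)
  where
  n<m : n < m
  n<m = m∸n≢0⇒n<m λ m∸n≡0 → 0≢1+n (trans (sym m∸n≡0) m∸n≡1+o)

diagonalUnion : Seq (ℕ × ℕ) → Seq ℕ
diagonalUnion E j y = Σ ℕ λ i → Σ ℕ λ x → i + x ≤ j × E i (x , y)

diagonalUnion∈ : {K : Family ℕ} → IsLatticeIdeal K → {E : Seq (ℕ × ℕ)} →
                 (∀ i → (∅⊗ K) (E i)) → ∀ j → K (diagonalUnion E j)
diagonalUnion∈ K-ideal {E} E∈ j =
  down _ _ bounded (⋃≤-closed K-ideal j _ λ i _ → ⋃≤-closed K-ideal j _ λ x _ → E∈ i x)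
  where
  open IsLatticeIdeal K-ideal
  bounded : diagonalUnion E j ⊆ λ y → Σ ℕ λ i → i ≤ j × Σ ℕ λ x → x ≤ j × E i (x , y)
  bounded y (i , x , i+x≤j , e) = i , m+n≤o⇒m≤o i i+x≤j , x , m+n≤o⇒n≤o i i+x≤j , e

Bad-staircase : ExcludedMiddle 0ℓ → {A : Seq ℕ} {E : Seq (ℕ × ℕ)} → ∀ {x y} →
                Bad (staircase A) E (x , y) →
                Bad A (disjointed (diagonalUnion E)) y × Σ ℕ λ k → A k y × x < k
Bad-staircase em {A} {E} {x} {y} (n , (k , a , k∸x≡1+n) , i , i≤n , e)
  with disjointed-cover em (diagonalUnion E) (i , x , +-monoˡ-≤ x i≤n , e)
... | j , j≤n+x , first =
  (n + x , subst (λ k → A k y) k≡1+n+x a , j , j≤n+x , first)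
  , k , a , subst (x <_) (sym k≡1+n+x) (s≤s (m≤n+m x n))
  where
  k≡1+n+x : k ≡ suc (n + x)
  k≡1+n+x = m∸n≡1+o⇒m≡1+o+n k∸x≡1+n

BsAtMost-∅⊗K⇒BsAtMost-K : ExcludedMiddle 0ℓ → {K : Family ℕ} {S : Set} → IsLatticeIdeal K →
                          BsAtMost FinIdeal (∅⊗ K) (∅⊗ K) S → BsAtMost FinIdeal K K S
BsAtMost-∅⊗K⇒BsAtMost-K em {K} {S} K-ideal (E , E∈ , wit) = D , D∈ , wit′
  where
  open IsLatticeIdeal K-ideal
  D : S → Seq ℕ
  D s = disjointed (diagonalUnion (E s))
  D∈ : ∀ s → PHat K (D s)
  D∈ s = (λ j → down _ _ (disjointed-⊆ _ j) (diagonalUnion∈ K-ideal (proj₁ (E∈ s)) j))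
       , disjointed-pairwiseDisjoint _
  wit′ : ∀ A → Part K A → Σ S λ s → ¬ FinIdeal (Bad A (D s))
  wit′ A A-part@((_ , A-disj) , cover) with wit _ (staircase-part K-ideal A-part)
  ... | s , ¬fin = s , λ fin → ¬fin (finite-⊆ Bad-below (finite-below index fin))
    where
    index : ℕ → ℕ
    index y = proj₁ (cover y)
    Bad-below : Bad (staircase A) (E s) ⊆ λ p → Bad A (D s) (proj₂ p) × proj₁ p < index (proj₂ p)
    Bad-below (x , y) bad with Bad-staircase em {A} {E s} bad
    ... | b , k , a , x<k = b , subst (x <_) (pairwiseDisjoint-unique A-disj a (proj₂ (cover y))) x<k

theorem5p5 : ExcludedMiddle 0ℓ → (J K : Family ℕ) → IsIdeal J → IsIdeal K →
    (BsIsAleph0 FinIdeal (J ⊗ K) (J ⊗ K)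
      × BsIsAleph0 FinIdeal (J ⊗∅) (J ⊗∅))
    × (∀ (S : Set) → BsAtMost FinIdeal (∅⊗ K) (∅⊗ K) S ⇔ BsAtMost FinIdeal K K S)
theorem5p5 em J K J-ideal K-ideal =
  ( ( BsAtMost-ℕ-columns em J⊗K-ideal (column∈J⊗K J-ideal K-ideal) (J⊗K∌columnwiseCofinite J-ideal K-ideal)
    , ¬BsAtMost-Fin em J⊗K-ideal proj₁ (column∈J⊗K J-ideal K-ideal) )
  , ( BsAtMost-ℕ-columns em J⊗∅-ideal (column∈J⊗∅ J-ideal) (J⊗∅∌columnwiseCofinite J-ideal)
    , ¬BsAtMost-Fin em J⊗∅-ideal proj₁ (column∈J⊗∅ J-ideal) ) )
  , λ S → mk⇔ (BsAtMost-∅⊗K⇒BsAtMost-K em (IsIdeal⇒IsLatticeIdeal K-ideal)) (BsAtMost-K⇒BsAtMost-∅⊗K {K})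
  where
  J⊗K-ideal : IsLatticeIdeal (J ⊗ K)
  J⊗K-ideal = ⊗-isLatticeIdeal J-ideal K-ideal em
  J⊗∅-ideal : IsLatticeIdeal (J ⊗∅)
  J⊗∅-ideal = ⊗∅-isLatticeIdeal J-ideal
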